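{- Let $f\in\widetilde S^0_n$. Then $\max_i\delta_i(f)=\max_i c_i(f)$ and $\min_i\delta_i(f)=-\max_i c_i(f^{ -1})$.
   Context: $\widetilde S_n$ is the group of bijections $f:\mathbb{Z}\to\mathbb{Z}$ with $f(i+n)=f(i)+n$; $s_i$ swaps $i+pn$ and $i+1+pn$ for all $p\in\mathbb{Z}$; $\widetilde S_n^0=\langle s_0,s_1,\dots,s_{n-1}\rangle$. $\delta_i(f)=f(i)-i$ and $c_i(f)=\#\{i'>i: f(i)>f(i')\}$ (both periodic in $i$ with period $n$). -}

module Defs where

open import Data.Nat as ℕ using (ℕ; NonZero)
open import Data.Nat.Base using (_≡ᵇ_; _%_)
open import Data.Integer as ℤ using (ℤ; +_; _%ℕ_; _+_; _-_; _≤_; -_)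
open import Data.Fin using (Fin; toℕ)
open import Data.List using (List; []; _∷_; length)
open import Data.List.Membership.Propositional using (_∈_)
open import Data.List.Relation.Unary.Unique.Propositional using (Unique)
open import Data.Bool using (if_then_else_)
open import Data.Product using (Σ; _×_; ∃)
open import Relation.Binary.PropositionalEquality using (_≡_)

-- The simple reflection s_i of the affine symmetric group (for n ≥ 2):
-- swaps i + p n and i + 1 + p n for all p ∈ ℤ.
s : (n : ℕ) .{{_ : NonZero n}} → Fin n → ℤ → ℤ
s n i x =
  if (x %ℕ n) ≡ᵇ toℕ i then x + + 1
  else if (x %ℕ n) ≡ᵇ ((toℕ i ℕ.+ 1) % n) then x - + 1
  else x

word : (n : ℕ) .{{_ : NonZero n}} → List (Fin n) → ℤ → ℤ
word n []       x = x
word n (i ∷ is) x = s n i (word n is x)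

-- f ∈ S̃ⁿ⁰ = ⟨s₀, …, s_{n-1}⟩ : f is (pointwise) a product of generators.
-- (Since each sᵢ is an involution, products of generators form the whole
-- generated subgroup.)
InS0 : (n : ℕ) .{{_ : NonZero n}} → (ℤ → ℤ) → Set
InS0 n f = ∃ λ (w : List (Fin n)) → ∀ x → f x ≡ word n w x

IsInverse : (ℤ → ℤ) → (ℤ → ℤ) → Set
IsInverse f g = (∀ x → g (f x) ≡ x) × (∀ x → f (g x) ≡ x)

δ : (ℤ → ℤ) → ℤ → ℤ
δ f i = f i - i

HasCard : (ℤ → Set) → ℕ → Set
HasCard P k = Σ (List ℤ) λ xs →
  Unique xs × length xs ≡ k × (∀ x → (x ∈ xs → P x) × (P x → x ∈ xs))

IsC : (ℤ → ℤ) → ℤ → ℕ → Set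
IsC f i k = HasCard (λ i' → (i ℤ.< i') × (f i' ℤ.< f i)) k

IsMax : (ℤ → ℤ) → ℤ → Set
IsMax a m = (∃ λ i → a i ≡ m) × (∀ i → a i ≤ m)

IsMin : (ℤ → ℤ) → ℤ → Set
IsMin a m = (∃ λ i → a i ≡ m) × (∀ i → m ≤ a i)

-- For an affine permutation f (a bijection of ℤ with f(x + n) = f x + n)
-- define the flux through the cut b at the level a,
--   Φ(b, a) = #{j ≥ b : f j < a} − #{j < b : f j ≥ a};
-- both sets are finite since the displacement δ f is periodic, hence bounded.
-- Moving the cut or the level by one transfers a single point between the two
-- sets, so Φ(b, a) = Φ(0, 0) + a − b.  Each sᵢ maps {x < i} onto itself, so
-- words in the sᵢ have Φ(0, 0) = 0 ("balanced").  For balanced f, at the cut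
-- i + 1 and level f i the first set is the set of inversions counted by cᵢ and
-- the second consists of the ℓᵢ ≥ 1 positions j ≤ i with f j ≥ f i, whence
--   cᵢ = δᵢ − 1 + ℓᵢ,  and cᵢ = δᵢ when i is a left-to-right maximum (ℓᵢ = 1).
-- Maximisers of δ and of c are left-to-right maxima, so max δ = max c.  The
-- inverse f⁻¹ is the reversed word, and δ f⁻¹ (f i) = − δ f i gives min δ.
module Submission where

open import Defs
open import Data.Nat using (ℕ; NonZero)
open import Data.Integer using (ℤ; +_; -_)
open import Data.Product using (_×_; ∃)
open import Relation.Binary.PropositionalEquality using (_≡_)

import Data.Nat as ℕ
import Data.Nat.Properties as ℕP
import Data.Nat.DivMod as ℕD
open import Data.Integer using (-[1+_]; _+_; _-_; _*_; _≤_; _<_; ∣_∣; _%ℕ_; _/ℕ_)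
import Data.Integer as ℤ
import Data.Integer.Properties as ℤP
open import Data.Integer.DivMod using (n%ℕd<d; a≡a%ℕn+[a/ℕn]*n)
open import Data.Integer.Tactic.RingSolver using (solve-∀)
open import Data.Fin using (Fin; toℕ)
open import Data.Fin.Properties using (toℕ<n)
open import Data.Bool using (true; false; T)
open import Data.List using (List; []; _∷_; _++_; length; filter; map; applyUpTo; upTo; reverse)
open import Data.List.Properties using (length-map; unfold-reverse; reverse-involutive)
open import Data.List.Membership.Propositional using (_∈_)
open import Data.List.Membership.Propositional.Properties
  using (∈-filter⁺; ∈-filter⁻; ∈-map⁺; ∈-map⁻; ∈-applyUpTo⁺; ∈-upTo⁺)
open import Data.List.Relation.Unary.Any using (here; there)
import Data.List.Relation.Unary.All as All
open import Data.List.Relation.Unary.AllPairs using ([]; _∷_)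
open import Data.List.Relation.Unary.Unique.Propositional using (Unique)
import Data.List.Relation.Unary.Unique.Propositional.Properties as UniqueP
import Data.List.Extrema ℤP.≤-totalOrder as Extrema
open import Data.Product using (_,_; proj₁; proj₂)
open import Data.Sum using (_⊎_; inj₁; inj₂; map₁; map₂)
open import Data.Empty using (⊥; ⊥-elim)
open import Relation.Nullary using (¬_; yes; no)
open import Relation.Nullary.Decidable using (_×-dec_)
open import Relation.Unary using (Decidable)
open import Relation.Binary.PropositionalEquality using (_≢_; refl; sym; trans; cong; cong₂; subst; subst₂; module ≡-Reasoning)

module Integers where

  [x+k]-k≡x : ∀ x k → (x + k) - k ≡ x
  [x+k]-k≡x = solve-∀

  [x-k]+k≡x : ∀ x k → (x - k) + k ≡ x
  [x-k]+k≡x = solve-∀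

  +-cancelʳ : ∀ {x y} k → x + k ≡ y + k → x ≡ y
  +-cancelʳ {x} {y} k eq = trans (sym ([x+k]-k≡x x k)) (trans (cong (_- k) eq) ([x+k]-k≡x y k))

  <⇒+1≤ : ∀ {x y} → x < y → x + + 1 ≤ y
  <⇒+1≤ {x} p = subst (_≤ _) (ℤP.+-comm (+ 1) x) (ℤP.i<j⇒suc[i]≤j p)

  +1≤⇒< : ∀ {x y} → x + + 1 ≤ y → x < y
  +1≤⇒< {x} p = ℤP.suc[i]≤j⇒i<j (subst (_≤ _) (ℤP.+-comm x (+ 1)) p)

  +1≤⇒≤ : ∀ {x y} → x + + 1 ≤ y → x ≤ y
  +1≤⇒≤ p = ℤP.<⇒≤ (+1≤⇒< p)

  ≤⇒<+1 : ∀ {x y} → x ≤ y → x < y + + 1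
  ≤⇒<+1 p = +1≤⇒< (ℤP.+-monoˡ-≤ (+ 1) p)

  <+1⇒≤ : ∀ {x y} → x < y + + 1 → x ≤ y
  <+1⇒≤ p = ℤP.≮⇒≥ λ y<x → ℤP.<-irrefl refl (ℤP.<-≤-trans p (<⇒+1≤ y<x))

  n<n+1 : ∀ x → x < x + + 1
  n<n+1 x = ≤⇒<+1 ℤP.≤-refl

  n-1<n : ∀ x → x - + 1 < x
  n-1<n x = subst (x - + 1 <_) ([x-k]+k≡x x (+ 1)) (n<n+1 (x - + 1))

  <⇒<+1 : ∀ {x y} → x < y → x < y + + 1
  <⇒<+1 {y = y} x<y = ℤP.<-trans x<y (n<n+1 y)

  ≤∧≢⇒+1≤ : ∀ {b x} → b ≤ x → x ≢ b → b + + 1 ≤ x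
  ≤∧≢⇒+1≤ b≤x x≢b = <⇒+1≤ (ℤP.≤∧≢⇒< b≤x (λ b≡x → x≢b (sym b≡x)))

  ≤-split : ∀ {b x} → b ≤ x → b + + 1 ≤ x ⊎ x ≡ b
  ≤-split {b} {x} b≤x with x ℤP.≟ b
  ... | yes x≡b = inj₂ x≡b
  ... | no  x≢b = inj₁ (≤∧≢⇒+1≤ b≤x x≢b)

  <+1∧≢⇒< : ∀ {b x} → x < b + + 1 → x ≢ b → x < b
  <+1∧≢⇒< x<b+1 x≢b = ℤP.≤∧≢⇒< (<+1⇒≤ x<b+1) x≢b

  <+1-split : ∀ {b x} → x < b + + 1 → x < b ⊎ x ≡ b
  <+1-split {b} {x} x<b+1 with x ℤP.≟ b
  ... | yes x≡b = inj₂ x≡b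
  ... | no  x≢b = inj₁ (<+1∧≢⇒< x<b+1 x≢b)

  step-invariant⇒constant : {A : Set} (F : ℤ → A) → (∀ x → F (x + + 1) ≡ F x) →
    ∀ x → F x ≡ F (+ 0)
  step-invariant⇒constant F step (+ ℕ.zero)     = refl
  step-invariant⇒constant F step (+ ℕ.suc k)    =
    trans (cong F (cong +_ (ℕP.+-comm 1 k))) (trans (step (+ k)) (step-invariant⇒constant F step (+ k)))
  step-invariant⇒constant F step -[1+ ℕ.zero ]  = sym (step -[1+ 0 ])
  step-invariant⇒constant F step -[1+ ℕ.suc k ] =
    trans (sym (step -[1+ ℕ.suc k ])) (step-invariant⇒constant F step -[1+ k ])

module Counting where

  private
    delete : {A : Set} {x : A} {ys : List A} → x ∈ ys →
      ∃ λ ys' → length ys ≡ ℕ.suc (length ys') × (∀ z → z ∈ ys → z ≡ x ⊎ z ∈ ys')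
    delete {ys = y ∷ ys} (here refl) = ys , refl , λ { z (here e) → inj₁ e ; z (there p) → inj₂ p }
    delete {ys = y ∷ ys} (there p) with delete p
    ... | ys' , len , split = y ∷ ys' , cong ℕ.suc len , λ
      { z (here e)  → inj₂ (here e)
      ; z (there q) → map₂ there (split z q) }

    unique-⊆⇒length-≤ : {A : Set} (xs ys : List A) → Unique xs →
      (∀ z → z ∈ xs → z ∈ ys) → length xs ℕ.≤ length ys
    unique-⊆⇒length-≤ [] ys _ _ = ℕ.z≤n
    unique-⊆⇒length-≤ (x ∷ xs) ys (x∉xs ∷ u) xs⊆ys with delete (xs⊆ys x (here refl))
    ... | ys' , len , split = subst (ℕ.suc (length xs) ℕ.≤_) (sym len)
      (ℕ.s≤s (unique-⊆⇒length-≤ xs ys' u λ z z∈xs → stays z z∈xs (split z (xs⊆ys z (there z∈xs)))))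
      where
      stays : ∀ z → z ∈ xs → z ≡ x ⊎ z ∈ ys' → z ∈ ys'
      stays z z∈xs (inj₁ refl) = ⊥-elim (All.lookup x∉xs z∈xs refl)
      stays z z∈xs (inj₂ z∈ys') = z∈ys'

  card-≤ : {P Q : ℤ → Set} {k l : ℕ} → HasCard P k → HasCard Q l → (∀ x → P x → Q x) → k ℕ.≤ l
  card-≤ (xs , u , refl , xs≈P) (ys , _ , refl , ys≈Q) P⊆Q =
    unique-⊆⇒length-≤ xs ys u λ z z∈xs → proj₂ (ys≈Q z) (P⊆Q z (proj₁ (xs≈P z) z∈xs))

  card-unique : {P Q : ℤ → Set} {k l : ℕ} → HasCard P k → HasCard Q l →
    (∀ x → P x → Q x) → (∀ x → Q x → P x) → k ≡ l
  card-unique hP hQ P⊆Q Q⊆P = ℕP.≤-antisym (card-≤ hP hQ P⊆Q) (card-≤ hQ hP Q⊆P)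

  card-none : HasCard (λ _ → ⊥) 0
  card-none = [] , [] , refl , λ x → (λ ()) , ⊥-elim

  card-extend : {P : ℤ → Set} {k : ℕ} {y : ℤ} → HasCard P k → ¬ P y →
    HasCard (λ x → P x ⊎ x ≡ y) (ℕ.suc k)
  card-extend {P} {y = y} (xs , u , len , xs≈P) ¬Py =
    y ∷ xs , All.tabulate (λ {z} z∈xs y≡z → ¬Py (subst P (sym y≡z) (proj₁ (xs≈P z) z∈xs))) ∷ u ,
    cong ℕ.suc len , λ x → member x , collect x
    where
    member : ∀ x → x ∈ y ∷ xs → P x ⊎ x ≡ y
    member x (here x≡y)  = inj₂ x≡y
    member x (there x∈xs) = inj₁ (proj₁ (xs≈P x) x∈xs)
    collect : ∀ x → P x ⊎ x ≡ y → x ∈ y ∷ xs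
    collect x (inj₁ Px)  = there (proj₂ (xs≈P x) Px)
    collect x (inj₂ x≡y) = here x≡y

  card-singleton : (y : ℤ) → HasCard (_≡ y) 1
  card-singleton y = y ∷ [] , All.[] ∷ [] , refl , λ x → (λ { (here x≡y) → x≡y }) , here

  card-image : {P Q : ℤ → Set} {k : ℕ} (h h⁻¹ : ℤ → ℤ) →
    (∀ x → h⁻¹ (h x) ≡ x) → (∀ x → h (h⁻¹ x) ≡ x) →
    HasCard P k → (∀ x → P x → Q (h x)) → (∀ x → Q x → P (h⁻¹ x)) → HasCard Q k
  card-image {P} {Q} h h⁻¹ h⁻¹∘h h∘h⁻¹ (xs , u , len , xs≈P) P→Q Q→P =
    map h xs , UniqueP.map⁺ h-injective u , trans (length-map h xs) len ,
    λ x → (λ m → image x (∈-map⁻ h m)) ,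
          λ Qx → subst (_∈ map h xs) (h∘h⁻¹ x) (∈-map⁺ h (proj₂ (xs≈P (h⁻¹ x)) (Q→P x Qx)))
    where
    h-injective : ∀ {x y} → h x ≡ h y → x ≡ y
    h-injective {x} {y} eq = trans (sym (h⁻¹∘h x)) (trans (cong h⁻¹ eq) (h⁻¹∘h y))
    image : ∀ x → (∃ λ y → y ∈ xs × x ≡ h y) → Q x
    image x (y , y∈xs , refl) = P→Q y (proj₁ (xs≈P y) y∈xs)

  window : ℤ → ℕ → List ℤ
  window lo = applyUpTo (λ k → lo + + k)

  card-exists : {P : ℤ → Set} → Decidable P → (lo hi : ℤ) →
    (∀ y → P y → lo ≤ y × y < hi) → ∃ λ k → HasCard P k
  card-exists {P} P? lo hi bounded =
    _ , filter P? xs , UniqueP.filter⁺ P? unique , refl ,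
    λ x → (λ m → proj₂ (∈-filter⁻ P? {xs = xs} m)) , λ Px → ∈-filter⁺ P? (in-window x (bounded x Px)) Px
    where
    N : ℕ
    N = ∣ hi - lo ∣
    xs : List ℤ
    xs = window lo N
    unique : Unique xs
    unique = UniqueP.applyUpTo⁺₁ (λ k → lo + + k) N λ i<j _ →
      ℤP.<⇒≢ (ℤP.+-monoʳ-< lo (ℤ.+<+ i<j))
    in-window : ∀ x → lo ≤ x × x < hi → x ∈ xs
    in-window x (lo≤x , x<hi) = subst (_∈ xs) lo+[x-lo]≡x (∈-applyUpTo⁺ (λ k → lo + + k) offset<N)
      where
      offset≡ : + ∣ x - lo ∣ ≡ x - lo
      offset≡ = ℤP.0≤i⇒+∣i∣≡i (ℤP.i≤j⇒0≤j-i lo≤x)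
      width≡ : + N ≡ hi - lo
      width≡ = ℤP.0≤i⇒+∣i∣≡i (ℤP.i≤j⇒0≤j-i (ℤP.<⇒≤ (ℤP.≤-<-trans lo≤x x<hi)))
      offset<N : ∣ x - lo ∣ ℕ.< N
      offset<N = ℤP.drop‿+<+ (subst₂ _<_ (sym offset≡) (sym width≡) (ℤP.+-monoˡ-< (- lo) x<hi))
      lo+[x-lo]≡x : lo + + ∣ x - lo ∣ ≡ x
      lo+[x-lo]≡x = trans (cong (λ d → lo + d) offset≡) (cancel lo x)
        where cancel : ∀ a b → a + (b - a) ≡ b
              cancel = solve-∀

module Residues (n : ℕ) .{{_ : NonZero n}} where
  open Integers

  remainder-unique : ∀ {r r'} (q q' : ℤ) → r ℕ.< n → r' ℕ.< n →
    + r + q * + n ≡ + r' + q' * + n → r ≡ r'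
  remainder-unique {r} {r'} q q' r<n r'<n eq = ℤP.+-injective (ℤP.i-j≡0⇒i≡j (+ r) (+ r') r-r'≡0)
    where
    d : ℤ
    d = q' - q
    r-r'≡dn : + r - + r' ≡ d * + n
    r-r'≡dn = begin
      + r - + r'                             ≡⟨ add-qn (+ r) (+ r') q (+ n) ⟩
      (+ r + q * + n) - (+ r' + q * + n)     ≡⟨ cong (_- (+ r' + q * + n)) eq ⟩
      (+ r' + q' * + n) - (+ r' + q * + n)   ≡⟨ cancel (+ r') q q' (+ n) ⟩
      d * + n                                ∎
      where
      open ≡-Reasoning
      add-qn : ∀ r r' q N → r - r' ≡ (r + q * N) - (r' + q * N)
      add-qn = solve-∀
      cancel : ∀ r' q q' N → (r' + q' * N) - (r' + q * N) ≡ (q' - q) * N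
      cancel = solve-∀
    -- |r − r'| < n forces d = 0.
    |d|n<n : ∣ d ∣ ℕ.* n ℕ.< n
    |d|n<n = subst (ℕ._< n) |r-r'|≡|d|n (ℕP.≤-<-trans (ℤP.∣m⊝n∣≤m⊔n r r') (ℕP.⊔-lub r<n r'<n))
      where
      |r-r'|≡|d|n : ∣ r ℤ.⊖ r' ∣ ≡ ∣ d ∣ ℕ.* n
      |r-r'|≡|d|n = trans (cong ∣_∣ (trans (sym (ℤP.m-n≡m⊖n r r')) r-r'≡dn)) (ℤP.abs-* d (+ n))
    d≡0 : d ≡ + 0
    d≡0 with ∣ d ∣ in |d|≡
    ... | ℕ.zero  = ℤP.∣i∣≡0⇒i≡0 |d|≡
    ... | ℕ.suc k = ⊥-elim (ℕP.<⇒≱ (subst (λ t → t ℕ.* n ℕ.< n) |d|≡ |d|n<n) (ℕP.m≤m+n n (k ℕ.* n)))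
    r-r'≡0 : + r - + r' ≡ + 0
    r-r'≡0 = trans r-r'≡dn (trans (cong (_* + n) d≡0) (ℤP.*-zeroˡ (+ n)))

  %ℕ-unique : ∀ x r q → r ℕ.< n → x ≡ + r + q * + n → x %ℕ n ≡ r
  %ℕ-unique x r q r<n eq =
    remainder-unique (x /ℕ n) q (n%ℕd<d x n) r<n (trans (sym (a≡a%ℕn+[a/ℕn]*n x n)) eq)

  %ℕ-+ : ∀ x k → (x + + k) %ℕ n ≡ (x %ℕ n ℕ.+ k) ℕ.% n
  %ℕ-+ x k = %ℕ-unique (x + + k) (m ℕ.% n) (q + + (m ℕ./ n)) (ℕD.m%n<n m n) (begin
      x + + k                                          ≡⟨ cong (_+ + k) (a≡a%ℕn+[a/ℕn]*n x n) ⟩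
      (+ r + q * + n) + + k                            ≡⟨ swap (+ r) q (+ n) (+ k) ⟩
      (+ r + + k) + q * + n                            ≡⟨ cong (_+ q * + n) (sym (ℤP.pos-+ r k)) ⟩
      + m + q * + n                                    ≡⟨ cong (_+ q * + n) m≡ ⟩
      (+ (m ℕ.% n) + + (m ℕ./ n) * + n) + q * + n      ≡⟨ collect (+ (m ℕ.% n)) (+ (m ℕ./ n)) q (+ n) ⟩
      + (m ℕ.% n) + (q + + (m ℕ./ n)) * + n            ∎)
    where
    open ≡-Reasoning
    r : ℕ
    r = x %ℕ n
    q : ℤ
    q = x /ℕ n
    m : ℕ
    m = r ℕ.+ k
    m≡ : + m ≡ + (m ℕ.% n) + + (m ℕ./ n) * + n
    m≡ = begin
      + m                                  ≡⟨ cong +_ (ℕD.m≡m%n+[m/n]*n m n) ⟩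
      + (m ℕ.% n ℕ.+ m ℕ./ n ℕ.* n)        ≡⟨ ℤP.pos-+ (m ℕ.% n) _ ⟩
      + (m ℕ.% n) + + (m ℕ./ n ℕ.* n)      ≡⟨ cong (λ z → + (m ℕ.% n) + z) (ℤP.pos-* (m ℕ./ n) n) ⟩
      + (m ℕ.% n) + + (m ℕ./ n) * + n      ∎
    swap : ∀ r q N k → (r + q * N) + k ≡ (r + k) + q * N
    swap = solve-∀
    collect : ∀ s p q N → (s + p * N) + q * N ≡ s + (q + p) * N
    collect = solve-∀

  %ℕ-+n : ∀ x → (x + + n) %ℕ n ≡ x %ℕ n
  %ℕ-+n x = trans (%ℕ-+ x n) (trans (ℕD.[m+n]%n≡m%n (x %ℕ n) n) (ℕD.m<n⇒m%n≡m (n%ℕd<d x n)))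

  suc-residue : ∀ {r} → r ℕ.< n → (r ℕ.+ 1) ℕ.% n ≡ ℕ.suc r ⊎ (ℕ.suc r ≡ n × (r ℕ.+ 1) ℕ.% n ≡ 0)
  suc-residue {r} r<n with ℕP.m≤n⇒m<n∨m≡n r<n
  ... | inj₁ 1+r<n = inj₁ (trans (cong (ℕ._% n) (ℕP.+-comm r 1)) (ℕD.m<n⇒m%n≡m 1+r<n))
  ... | inj₂ 1+r≡n = inj₂ (1+r≡n , trans (cong (ℕ._% n) (trans (ℕP.+-comm r 1) 1+r≡n)) (ℕD.n%n≡0 n))

  suc-residue-injective : ∀ {t r} → t ℕ.< n → r ℕ.< n → (t ℕ.+ 1) ℕ.% n ≡ (r ℕ.+ 1) ℕ.% n → t ≡ r
  suc-residue-injective t<n r<n eq with suc-residue t<n | suc-residue r<n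
  ... | inj₁ e | inj₁ e'             = ℕP.suc-injective (trans (sym e) (trans eq e'))
  ... | inj₁ e | inj₂ (_ , e')       = ⊥-elim (ℕP.1+n≢0 (trans (sym e) (trans eq e')))
  ... | inj₂ (_ , e) | inj₁ e'       = ⊥-elim (ℕP.1+n≢0 (trans (sym e') (trans (sym eq) e)))
  ... | inj₂ (w , _) | inj₂ (w' , _) = ℕP.suc-injective (trans w (sym w'))

  %ℕ-pred : ∀ x {r} → r ℕ.< n → x %ℕ n ≡ (r ℕ.+ 1) ℕ.% n → (x - + 1) %ℕ n ≡ r
  %ℕ-pred x {r} r<n eq = suc-residue-injective (n%ℕd<d (x - + 1) n) r<n (begin
      ((x - + 1) %ℕ n ℕ.+ 1) ℕ.% n   ≡⟨ sym (%ℕ-+ (x - + 1) 1) ⟩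
      ((x - + 1) + + 1) %ℕ n          ≡⟨ cong (_%ℕ n) ([x-k]+k≡x x (+ 1)) ⟩
      x %ℕ n                          ≡⟨ eq ⟩
      (r ℕ.+ 1) ℕ.% n                 ∎)
    where open ≡-Reasoning

module Reflections (n : ℕ) .{{_ : NonZero n}} (2≤n : 2 ℕ.≤ n) where
  open Integers
  open Residues n

  next : Fin n → ℕ
  next i = (toℕ i ℕ.+ 1) ℕ.% n

  next≢ : ∀ i → next i ≢ toℕ i
  next≢ i eq with suc-residue (toℕ<n i)
  ... | inj₁ e            = ℕP.1+n≢n (trans (sym e) eq)
  ... | inj₂ (1+i≡n , e)  = ℕP.<-irrefl (trans (cong ℕ.suc (sym (trans (sym eq) e))) 1+i≡n) 2≤n

  s-periodic : ∀ i x → s n i (x + + n) ≡ s n i x + + n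
  s-periodic i x rewrite %ℕ-+n x with x %ℕ n ℕ.≡ᵇ toℕ i | x %ℕ n ℕ.≡ᵇ next i
  ... | true  | _     = swap x (+ 1) (+ n)
    where swap : ∀ x a b → (x + b) + a ≡ (x + a) + b
          swap = solve-∀
  ... | false | true  = swap x (+ 1) (+ n)
    where swap : ∀ x a b → (x + b) - a ≡ (x - a) + b
          swap = solve-∀
  ... | false | false = refl

  private
    ≡ᵇ-true : ∀ {a b} → a ≡ b → (a ℕ.≡ᵇ b) ≡ true
    ≡ᵇ-true {a} {b} a≡b with a ℕ.≡ᵇ b | ℕP.≡⇒≡ᵇ a b a≡b
    ... | true | _ = refl

    ≡ᵇ-false : ∀ {a b} → a ≢ b → (a ℕ.≡ᵇ b) ≡ false
    ≡ᵇ-false {a} {b} a≢b with a ℕ.≡ᵇ b in eq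
    ... | false = refl
    ... | true  = ⊥-elim (a≢b (ℕP.≡ᵇ⇒≡ a b (subst T (sym eq) _)))

    %ℕ-next : ∀ i x → x %ℕ n ≡ toℕ i → (x + + 1) %ℕ n ≡ next i
    %ℕ-next i x at-i = trans (%ℕ-+ x 1) (cong (λ r → (r ℕ.+ 1) ℕ.% n) at-i)

  s-at-i : ∀ i x → x %ℕ n ≡ toℕ i → s n i x ≡ x + + 1
  s-at-i i x at-i rewrite ≡ᵇ-true at-i = refl

  s-at-next : ∀ i x → x %ℕ n ≡ next i → s n i x ≡ x - + 1
  s-at-next i x at-next
    rewrite ≡ᵇ-false (λ at-i → next≢ i (trans (sym at-next) at-i)) | ≡ᵇ-true at-next = refl

  s-elsewhere : ∀ i x → x %ℕ n ≢ toℕ i → x %ℕ n ≢ next i → s n i x ≡ x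
  s-elsewhere i x ¬at-i ¬at-next rewrite ≡ᵇ-false ¬at-i | ≡ᵇ-false ¬at-next = refl

  data Move (i : Fin n) (x : ℤ) : Set where
    up   : x %ℕ n ≡ toℕ i → s n i x ≡ x + + 1 → Move i x
    down : x %ℕ n ≡ next i → s n i x ≡ x - + 1 → Move i x
    stay : s n i x ≡ x → Move i x

  move : ∀ i x → Move i x
  move i x with x %ℕ n ℕP.≟ toℕ i | x %ℕ n ℕP.≟ next i
  ... | yes at-i | _            = up at-i (s-at-i i x at-i)
  ... | no _     | yes at-next  = down at-next (s-at-next i x at-next)
  ... | no ¬at-i | no ¬at-next  = stay (s-elsewhere i x ¬at-i ¬at-next)

  s-involutive : ∀ i x → s n i (s n i x) ≡ x
  s-involutive i x with move i x
  ... | up at-i sx≡ rewrite sx≡ =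
    trans (s-at-next i (x + + 1) (%ℕ-next i x at-i)) ([x+k]-k≡x x (+ 1))
  ... | down at-next sx≡ rewrite sx≡ =
    trans (s-at-i i (x - + 1) (%ℕ-pred x (toℕ<n i) at-next)) ([x-k]+k≡x x (+ 1))
  ... | stay sx≡ rewrite sx≡ = sx≡

  s-below : ∀ i x → x < + toℕ i → s n i x < + toℕ i
  s-below i x x<i with move i x
  ... | up at-i sx≡ rewrite sx≡ =
    ℤP.≤∧≢⇒< (<⇒+1≤ x<i) λ x+1≡i → next≢ i (begin
      next i                 ≡⟨ sym (%ℕ-next i x at-i) ⟩
      (x + + 1) %ℕ n         ≡⟨ cong (_%ℕ n) x+1≡i ⟩
      (+ toℕ i) %ℕ n         ≡⟨ ℕD.m<n⇒m%n≡m (toℕ<n i) ⟩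
      toℕ i                  ∎)
    where open ≡-Reasoning
  ... | down _ sx≡ rewrite sx≡ = ℤP.<-trans (n-1<n x) x<i
  ... | stay sx≡ rewrite sx≡ = x<i

  s-below⁻ : ∀ i x → s n i x < + toℕ i → x < + toℕ i
  s-below⁻ i x sx<i = subst (_< + toℕ i) (s-involutive i x) (s-below i (s n i x) sx<i)

module Words (n : ℕ) .{{_ : NonZero n}} (2≤n : 2 ℕ.≤ n) where
  open Reflections n 2≤n

  word-periodic : ∀ w x → word n w (x + + n) ≡ word n w x + + n
  word-periodic []      x = refl
  word-periodic (i ∷ w) x = trans (cong (s n i) (word-periodic w x)) (s-periodic i (word n w x))

  word-++ : ∀ u v x → word n (u ++ v) x ≡ word n u (word n v x)
  word-++ []      v x = refl
  word-++ (i ∷ u) v x = cong (s n i) (word-++ u v x)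

  -- Since every sᵢ is an involution, the reversed word is the inverse.
  word-reverse-inverseˡ : ∀ w x → word n (reverse w) (word n w x) ≡ x
  word-reverse-inverseˡ []      x = refl
  word-reverse-inverseˡ (i ∷ w) x = begin
    word n (reverse (i ∷ w)) (s n i (word n w x))       ≡⟨ cong (λ u → word n u y) (unfold-reverse i w) ⟩
    word n (reverse w ++ i ∷ []) (s n i (word n w x))   ≡⟨ word-++ (reverse w) (i ∷ []) _ ⟩
    word n (reverse w) (s n i (s n i (word n w x)))     ≡⟨ cong (word n (reverse w)) (s-involutive i _) ⟩
    word n (reverse w) (word n w x)                     ≡⟨ word-reverse-inverseˡ w x ⟩
    x                                                   ∎
    where
    open ≡-Reasoning
    y : ℤ
    y = s n i (word n w x)

  word-reverse-inverseʳ : ∀ w x → word n w (word n (reverse w) x) ≡ x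
  word-reverse-inverseʳ w x =
    subst (λ u → word n u (word n (reverse w) x) ≡ x) (reverse-involutive w)
      (word-reverse-inverseˡ (reverse w) x)

-- Extrema of n-periodic functions ℤ → ℤ: they are attained on 0, …, n − 1.
module PeriodicExtrema (n : ℕ) .{{_ : NonZero n}} where
  open Integers

  Periodic : (ℤ → ℤ) → Set
  Periodic h = ∀ x → h (x + + n) ≡ h x

  periodic-residue : ∀ {h} → Periodic h → ∀ x → h x ≡ h (+ (x %ℕ n))
  periodic-residue {h} per x = begin
    h x                                ≡⟨ cong h (a≡a%ℕn+[a/ℕn]*n x n) ⟩
    h (+ (x %ℕ n) + (x /ℕ n) * + n)    ≡⟨ step-invariant⇒constant along-orbit step (x /ℕ n) ⟩
    h (+ (x %ℕ n) + + 0 * + n)         ≡⟨ cong h (ℤP.+-identityʳ (+ (x %ℕ n))) ⟩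
    h (+ (x %ℕ n))                     ∎
    where
    open ≡-Reasoning
    along-orbit : ℤ → ℤ
    along-orbit q = h (+ (x %ℕ n) + q * + n)
    step : ∀ q → along-orbit (q + + 1) ≡ along-orbit q
    step q = trans (cong h (distrib (+ (x %ℕ n)) q (+ n))) (per _)
      where distrib : ∀ r q N → r + (q + + 1) * N ≡ (r + q * N) + N
            distrib = solve-∀

  private
    residues : List ℤ
    residues = map +_ (upTo n)

    residue∈residues : ∀ x → + (x %ℕ n) ∈ residues
    residue∈residues x = ∈-map⁺ +_ (∈-upTo⁺ (n%ℕd<d x n))

  periodic-max : ∀ {h} → Periodic h → ∃ λ i → ∀ x → h x ≤ h i
  periodic-max {h} per = Extrema.argmax h (+ 0) residues , λ x →
    ℤP.≤-trans (ℤP.≤-reflexive (periodic-residue per x))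
      (All.lookup (Extrema.f[xs]≤f[argmax] {f = h} (+ 0) residues) (residue∈residues x))

  periodic-min : ∀ {h} → Periodic h → ∃ λ i → ∀ x → h i ≤ h x
  periodic-min {h} per = Extrema.argmin h (+ 0) residues , λ x →
    ℤP.≤-trans (All.lookup (Extrema.f[argmin]≤f[xs] {f = h} (+ 0) residues) (residue∈residues x))
      (ℤP.≤-reflexive (sym (periodic-residue per x)))

module AffinePermutation (n : ℕ) .{{_ : NonZero n}} (f g : ℤ → ℤ)
    (f-periodic : ∀ x → f (x + + n) ≡ f x + + n)
    (g∘f : ∀ x → g (f x) ≡ x) (f∘g : ∀ x → f (g x) ≡ x) where
  open Integers
  open Counting
  open PeriodicExtrema n

  f-injective : ∀ {x y} → f x ≡ f y → x ≡ y
  f-injective {x} {y} fx≡fy = trans (sym (g∘f x)) (trans (cong g fx≡fy) (g∘f y))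

  f-periodic⁻ : ∀ x → f (x - + n) ≡ f x - + n
  f-periodic⁻ x = begin
    f (x - + n)                  ≡⟨ sym ([x+k]-k≡x (f (x - + n)) (+ n)) ⟩
    (f (x - + n) + + n) - + n    ≡⟨ cong (_- + n) (sym (f-periodic (x - + n))) ⟩
    f ((x - + n) + + n) - + n    ≡⟨ cong (λ y → f y - + n) ([x-k]+k≡x x (+ n)) ⟩
    f x - + n                    ∎
    where open ≡-Reasoning

  δ-periodic : Periodic (δ f)
  δ-periodic x = trans (cong (_- (x + + n)) (f-periodic x)) (cancel (f x) x (+ n))
    where cancel : ∀ y x N → (y + N) - (x + N) ≡ y - x
          cancel = solve-∀

  abstract
    i-max : ℤ
    i-max = proj₁ (periodic-max δ-periodic)

    δ≤max : ∀ x → δ f x ≤ δ f i-max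
    δ≤max = proj₂ (periodic-max δ-periodic)

    i-min : ℤ
    i-min = proj₁ (periodic-min δ-periodic)

    min≤δ : ∀ x → δ f i-min ≤ δ f x
    min≤δ = proj₂ (periodic-min δ-periodic)

  preimage : ∀ {x a} → f x ≡ a → x ≡ g a
  preimage {x} {a} fx≡a = f-injective (trans fx≡a (sym (f∘g a)))

  private
    unshift : ∀ y x → y - (y - x) ≡ x
    unshift = solve-∀

    -- x = f x − δ f x, so bounds on f x and δ f bound x.
    below-level : ∀ {x a} → f x < a → x < a - δ f i-min
    below-level {x} {a} fx<a = subst (_< a - δ f i-min) (unshift (f x) x)
      (ℤP.≤-<-trans (ℤP.+-monoʳ-≤ (f x) (ℤP.neg-mono-≤ (min≤δ x))) (ℤP.+-monoˡ-< (- δ f i-min) fx<a))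

    above-level : ∀ {x a} → a ≤ f x → a - δ f i-max ≤ x
    above-level {x} {a} a≤fx = subst (a - δ f i-max ≤_) (unshift (f x) x)
      (ℤP.≤-trans (ℤP.+-monoˡ-≤ (- δ f i-max) a≤fx) (ℤP.+-monoʳ-≤ (f x) (ℤP.neg-mono-≤ (δ≤max x))))

  Down Up : ℤ → ℤ → ℤ → Set
  Down b a x = b ≤ x × f x < a
  Up   b a x = x < b × a ≤ f x

  abstract
    Down-finite : ∀ b a → ∃ λ k → HasCard (Down b a) k
    Down-finite b a = card-exists (λ x → (b ℤP.≤? x) ×-dec (f x ℤP.<? a)) b (a - δ f i-min)
      λ x (b≤x , fx<a) → b≤x , below-level fx<a

    Up-finite : ∀ b a → ∃ λ k → HasCard (Up b a) k
    Up-finite b a = card-exists (λ x → (x ℤP.<? b) ×-dec (a ℤP.≤? f x)) (a - δ f i-max) b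
      λ x (x<b , a≤fx) → above-level a≤fx , x<b

  #Down #Up : ℤ → ℤ → ℕ
  #Down b a = proj₁ (Down-finite b a)
  #Up   b a = proj₁ (Up-finite b a)

  Down-card : ∀ b a → HasCard (Down b a) (#Down b a)
  Down-card b a = proj₂ (Down-finite b a)

  Up-card : ∀ b a → HasCard (Up b a) (#Up b a)
  Up-card b a = proj₂ (Up-finite b a)

  flux : ℤ → ℤ → ℤ
  flux b a = + #Down b a - + #Up b a

  private
    move-one : ∀ {p q p' q'} → (p' ≡ ℕ.suc p × q' ≡ q) ⊎ (p' ≡ p × q ≡ ℕ.suc q') →
      + p' - + q' ≡ (+ p - + q) + + 1
    move-one {p} {q} (inj₁ (refl , refl)) = shift (+ p) (+ q)
      where shift : ∀ p q → (+ 1 + p) - q ≡ (p - q) + + 1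
            shift = solve-∀
    move-one {p} {q' = q'} (inj₂ (refl , refl)) = shift (+ p) (+ q')
      where shift : ∀ p q → p - q ≡ (p - (+ 1 + q)) + + 1
            shift = solve-∀

  -- Moving the cut from b to b + 1 moves the point b from the right to the left.
  flux-step-cut : ∀ b a → flux b a ≡ flux (b + + 1) a + + 1
  flux-step-cut b a with f b ℤP.<? a
  ... | yes fb<a = move-one (inj₁ (Down-grows , Up-same))
    where
    b∉Down : ¬ Down (b + + 1) a b
    b∉Down (b+1≤b , _) = ℤP.<-irrefl refl (+1≤⇒< b+1≤b)
    Down-grows : #Down b a ≡ ℕ.suc (#Down (b + + 1) a)
    Down-grows = card-unique (Down-card b a) (card-extend (Down-card (b + + 1) a) b∉Down)
      (λ x (b≤x , fx<a) → map₁ (_, fx<a) (≤-split b≤x))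
      λ { x (inj₁ (b+1≤x , fx<a)) → +1≤⇒≤ b+1≤x , fx<a
        ; x (inj₂ refl)           → ℤP.≤-refl , fb<a }
    Up-same : #Up b a ≡ #Up (b + + 1) a
    Up-same = card-unique (Up-card b a) (Up-card (b + + 1) a)
      (λ x (x<b , a≤fx) → <⇒<+1 x<b , a≤fx)
      λ x (x<b+1 , a≤fx) → <+1∧≢⇒< x<b+1 (λ { refl → ℤP.<⇒≱ fb<a a≤fx }) , a≤fx
  ... | no fb≮a = move-one (inj₂ (Down-same , Up-grows))
    where
    a≤fb : a ≤ f b
    a≤fb = ℤP.≮⇒≥ fb≮a
    b∉Up : ¬ Up b a b
    b∉Up (b<b , _) = ℤP.<-irrefl refl b<b
    Down-same : #Down b a ≡ #Down (b + + 1) a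
    Down-same = card-unique (Down-card b a) (Down-card (b + + 1) a)
      (λ x (b≤x , fx<a) → ≤∧≢⇒+1≤ b≤x (λ { refl → ℤP.<⇒≱ fx<a a≤fb }) , fx<a)
      λ x (b+1≤x , fx<a) → +1≤⇒≤ b+1≤x , fx<a
    Up-grows : #Up (b + + 1) a ≡ ℕ.suc (#Up b a)
    Up-grows = card-unique (Up-card (b + + 1) a) (card-extend (Up-card b a) b∉Up)
      (λ x (x<b+1 , a≤fx) → map₁ (_, a≤fx) (<+1-split x<b+1))
      λ { x (inj₁ (x<b , a≤fx)) → <⇒<+1 x<b , a≤fx
        ; x (inj₂ refl)         → n<n+1 b , a≤fb }

  -- Raising the level from a to a + 1 moves the unique point y = g a with value a.
  flux-step-level : ∀ b a → flux b (a + + 1) ≡ flux b a + + 1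
  flux-step-level b a with b ℤP.≤? g a
  ... | yes b≤y = move-one (inj₁ (Down-grows , Up-same))
    where
    y∉Down : ¬ Down b a (g a)
    y∉Down (_ , fy<a) = ℤP.<-irrefl (f∘g a) fy<a
    Down-grows : #Down b (a + + 1) ≡ ℕ.suc (#Down b a)
    Down-grows = card-unique (Down-card b (a + + 1)) (card-extend (Down-card b a) y∉Down)
      (λ x (b≤x , fx<a+1) → map₁ (b≤x ,_) (map₂ preimage (<+1-split fx<a+1)))
      λ { x (inj₁ (b≤x , fx<a)) → b≤x , <⇒<+1 fx<a
        ; x (inj₂ refl)         → b≤y , ≤⇒<+1 (ℤP.≤-reflexive (f∘g a)) }
    Up-same : #Up b (a + + 1) ≡ #Up b a
    Up-same = card-unique (Up-card b (a + + 1)) (Up-card b a)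
      (λ x (x<b , a+1≤fx) → x<b , +1≤⇒≤ a+1≤fx)
      λ x (x<b , a≤fx) →
        x<b , ≤∧≢⇒+1≤ a≤fx (λ fx≡a → ℤP.<⇒≱ x<b (subst (b ≤_) (sym (preimage fx≡a)) b≤y))
  ... | no b≰y = move-one (inj₂ (Down-same , Up-shrinks))
    where
    y<b : g a < b
    y<b = ℤP.≰⇒> b≰y
    y∉Up : ¬ Up b (a + + 1) (g a)
    y∉Up (_ , a+1≤fy) = ℤP.<-irrefl (sym (f∘g a)) (+1≤⇒< a+1≤fy)
    Down-same : #Down b (a + + 1) ≡ #Down b a
    Down-same = card-unique (Down-card b (a + + 1)) (Down-card b a)
      (λ x (b≤x , fx<a+1) →
        b≤x , <+1∧≢⇒< fx<a+1 (λ fx≡a → ℤP.<⇒≱ y<b (subst (b ≤_) (preimage fx≡a) b≤x)))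
      λ x (b≤x , fx<a) → b≤x , <⇒<+1 fx<a
    Up-shrinks : #Up b a ≡ ℕ.suc (#Up b (a + + 1))
    Up-shrinks = card-unique (Up-card b a) (card-extend (Up-card b (a + + 1)) y∉Up)
      (λ x (x<b , a≤fx) → map₁ (x<b ,_) (map₂ preimage (≤-split a≤fx)))
      λ { x (inj₁ (x<b , a+1≤fx)) → x<b , +1≤⇒≤ a+1≤fx
        ; x (inj₂ refl)           → y<b , ℤP.≤-reflexive (sym (f∘g a)) }

  flux-formula : ∀ b a → flux b a ≡ flux (+ 0) (+ 0) + (a - b)
  flux-formula b a = begin
    flux b a                           ≡⟨ recombine (flux b a) a b ⟩
    offset b a + (a - b)               ≡⟨ cong (_+ (a - b)) (step-invariant⇒constant (offset b) (offset-level b) a) ⟩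
    offset b (+ 0) + (a - b)           ≡⟨ cong (_+ (a - b)) (step-invariant⇒constant (λ b → offset b (+ 0))
                                                                                      (λ b → offset-cut b (+ 0)) b) ⟩
    offset (+ 0) (+ 0) + (a - b)       ≡⟨ cong (_+ (a - b)) (ℤP.+-identityʳ (flux (+ 0) (+ 0))) ⟩
    flux (+ 0) (+ 0) + (a - b)         ∎
    where
    open ≡-Reasoning
    -- The flux corrected by the expected value a − b is invariant under both steps.
    offset : ℤ → ℤ → ℤ
    offset b a = flux b a - (a - b)
    recombine : ∀ φ a b → φ ≡ (φ - (a - b)) + (a - b)
    recombine = solve-∀
    offset-level : ∀ b a → offset b (a + + 1) ≡ offset b a
    offset-level b a = trans (cong (_- ((a + + 1) - b)) (flux-step-level b a)) (shift (flux b a) a b)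
      where shift : ∀ φ a b → (φ + + 1) - ((a + + 1) - b) ≡ φ - (a - b)
            shift = solve-∀
    offset-cut : ∀ b a → offset (b + + 1) a ≡ offset b a
    offset-cut b a = sym (trans (cong (_- (a - b)) (flux-step-cut b a)) (shift (flux (b + + 1) a) a b))
      where shift : ∀ φ a b → (φ + + 1) - (a - b) ≡ φ - (a - (b + + 1))
            shift = solve-∀

  module Balanced (balanced : flux (+ 0) (+ 0) ≡ + 0) (c : ℤ → ℕ) (c-spec : ∀ i → IsC f i (c i)) where

    flux≡ : ∀ b a → flux b a ≡ a - b
    flux≡ b a = trans (flux-formula b a) (trans (cong (_+ (a - b)) balanced) (ℤP.+-identityˡ (a - b)))

    -- ℓ i counts the positions j ≤ i with f j ≥ f i; it includes i itself.
    ℓ : ℤ → ℕ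
    ℓ i = #Up (i + + 1) (f i)

    -- The inversions to the right of i are the points right of the cut i + 1 below level f i …
    c≡#Down : ∀ i → c i ≡ #Down (i + + 1) (f i)
    c≡#Down i = card-unique (c-spec i) (Down-card (i + + 1) (f i))
      (λ x (i<x , fx<fi) → <⇒+1≤ i<x , fx<fi) (λ x (i+1≤x , fx<fi) → +1≤⇒< i+1≤x , fx<fi)

    c-formula : ∀ i → + c i ≡ (δ f i - + 1) + + ℓ i
    c-formula i = begin
      + c i                                       ≡⟨ cong +_ (c≡#Down i) ⟩
      + #Down (i + + 1) (f i)                     ≡⟨ recombine (+ #Down (i + + 1) (f i)) (+ ℓ i) ⟩
      flux (i + + 1) (f i) + + ℓ i                ≡⟨ cong (_+ + ℓ i) (flux≡ (i + + 1) (f i)) ⟩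
      (f i - (i + + 1)) + + ℓ i                   ≡⟨ cong (_+ + ℓ i) (regroup (f i) i) ⟩
      (δ f i - + 1) + + ℓ i                       ∎
      where
      open ≡-Reasoning
      recombine : ∀ d u → d ≡ (d - u) + u
      recombine = solve-∀
      regroup : ∀ y i → y - (i + + 1) ≡ (y - i) - + 1
      regroup = solve-∀

    LeftToRightMax : ℤ → Set
    LeftToRightMax i = ∀ j → j < i → f j < f i

    -- At a left-to-right maximum ℓᵢ = 1, hence cᵢ = δᵢ.
    c≡δ : ∀ i → LeftToRightMax i → + c i ≡ δ f i
    c≡δ i ltr = begin
      + c i                    ≡⟨ c-formula i ⟩
      (δ f i - + 1) + + ℓ i    ≡⟨ cong (λ l → (δ f i - + 1) + + l) ℓ≡1 ⟩
      (δ f i - + 1) + + 1      ≡⟨ [x-k]+k≡x (δ f i) (+ 1) ⟩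
      δ f i                    ∎
      where
      open ≡-Reasoning
      ℓ≡1 : ℓ i ≡ 1
      ℓ≡1 = card-unique (Up-card (i + + 1) (f i)) (card-singleton i)
        (λ j (j<i+1 , fi≤fj) → ℤP.≤∧≮⇒≡ (<+1⇒≤ j<i+1) λ j<i → ℤP.<⇒≱ (ltr j j<i) fi≤fj)
        λ { j refl → n<n+1 i , ℤP.≤-refl }

    -- A maximiser of δ is a left-to-right maximum: an earlier larger value
    -- would have a larger displacement.
    δ-max-is-LTR : LeftToRightMax i-max
    δ-max-is-LTR j j<i = ℤP.≰⇒> λ fi≤fj →
      ℤP.<⇒≱ (ℤP.+-mono-≤-< fi≤fj (ℤP.neg-mono-< j<i)) (δ≤max j)

    -- A maximiser of c is a left-to-right maximum: an earlier larger value j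
    -- would have all inversions of i, and i itself, as inversions.
    c-max-is-LTR : ∀ i → (∀ j → c j ℕ.≤ c i) → LeftToRightMax i
    c-max-is-LTR i c≤ci j j<i = ℤP.≰⇒> λ fi≤fj → ℕP.<⇒≱ (more-inversions fi≤fj) (c≤ci j)
      where
      more-inversions : f i ≤ f j → c i ℕ.< c j
      more-inversions fi≤fj = card-≤ (card-extend (c-spec i) (λ (i<i , _) → ℤP.<-irrefl refl i<i)) (c-spec j)
        λ { x (inj₁ (i<x , fx<fi)) → ℤP.<-trans j<i i<x , ℤP.<-≤-trans fx<fi fi≤fj
          ; x (inj₂ refl)          →
              j<i , ℤP.≤∧≢⇒< fi≤fj (λ fi≡fj → ℤP.<-irrefl (f-injective (sym fi≡fj)) j<i) }

    -- Translating by n maps the inversions of i onto those of i + n.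
    c-periodic : ∀ i → c (i + + n) ≡ c i
    c-periodic i = card-unique (c-spec (i + + n))
      (card-image (_+ + n) (_- + n) (λ x → [x+k]-k≡x x (+ n)) (λ x → [x-k]+k≡x x (+ n)) (c-spec i)
        (λ x (i<x , fx<fi) → ℤP.+-monoˡ-< (+ n) i<x ,
          subst₂ _<_ (sym (f-periodic x)) (sym (f-periodic i)) (ℤP.+-monoˡ-< (+ n) fx<fi))
        λ x (i+n<x , fx<fi+n) →
          subst (_< x - + n) ([x+k]-k≡x i (+ n)) (ℤP.+-monoˡ-< (- + n) i+n<x) ,
          subst₂ _<_ (sym (f-periodic⁻ x)) (trans (cong (_- + n) (f-periodic i)) ([x+k]-k≡x (f i) (+ n)))
            (ℤP.+-monoˡ-< (- + n) fx<fi+n))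
      (λ _ z → z) (λ _ z → z)

    max-δ≡max-c : ∃ λ m → IsMax (δ f) m × IsMax (λ i → + c i) m
    max-δ≡max-c = δ f i-max , ((i-max , refl) , δ≤max) , ((i-max , c≡δ i-max δ-max-is-LTR) , c≤max)
      where
      c-max : ∃ λ i₁ → ∀ i → + c i ≤ + c i₁
      c-max = periodic-max (λ i → cong +_ (c-periodic i))
      i₁ : ℤ
      i₁ = proj₁ c-max
      c≤max : ∀ i → + c i ≤ δ f i-max
      c≤max i = begin
        + c i      ≤⟨ proj₂ c-max i ⟩
        + c i₁     ≡⟨ c≡δ i₁ (c-max-is-LTR i₁ λ j → ℤP.drop‿+≤+ (proj₂ c-max j)) ⟩
        δ f i₁     ≤⟨ δ≤max i₁ ⟩
        δ f i-max  ∎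
        where open ℤP.≤-Reasoning

module WordBalance (n : ℕ) .{{_ : NonZero n}} (2≤n : 2 ℕ.≤ n) where
  open Reflections n 2≤n
  open Words n 2≤n
  open Integers
  open Counting

  module W (w : List (Fin n)) = AffinePermutation n (word n w) (word n (reverse w))
    (word-periodic w) (word-reverse-inverseˡ w) (word-reverse-inverseʳ w)

  word-balanced : ∀ w → W.flux w (+ 0) (+ 0) ≡ + 0
  word-balanced [] = cong₂ (λ p q → + p - + q)
    (card-unique (W.Down-card [] (+ 0) (+ 0)) card-none (λ x (0≤x , x<0) → ℤP.<⇒≱ x<0 0≤x) λ x ())
    (card-unique (W.Up-card [] (+ 0) (+ 0)) card-none (λ x (x<0 , 0≤x) → ℤP.<⇒≱ x<0 0≤x) λ x ())
  word-balanced (i ∷ w) = +-cancelʳ (a - + 0) (begin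
    W.flux (i ∷ w) (+ 0) (+ 0) + (a - + 0)   ≡⟨ sym (W.flux-formula (i ∷ w) (+ 0) a) ⟩
    W.flux (i ∷ w) (+ 0) a                   ≡⟨ cong₂ (λ p q → + p - + q) same-Down same-Up ⟩
    W.flux w (+ 0) a                         ≡⟨ W.flux-formula w (+ 0) a ⟩
    W.flux w (+ 0) (+ 0) + (a - + 0)         ≡⟨ cong (_+ (a - + 0)) (word-balanced w) ⟩
    + 0 + (a - + 0)                          ∎)
    where
    open ≡-Reasoning
    -- sᵢ preserves the half-lines {x < i} and {x ≥ i}, so at level i the
    -- sets counted by the flux do not change.
    a : ℤ
    a = + toℕ i
    same-Down : W.#Down (i ∷ w) (+ 0) a ≡ W.#Down w (+ 0) a
    same-Down = card-unique (W.Down-card (i ∷ w) (+ 0) a) (W.Down-card w (+ 0) a)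
      (λ x (0≤x , sv<a) → 0≤x , s-below⁻ i _ sv<a) (λ x (0≤x , v<a) → 0≤x , s-below i _ v<a)
    same-Up : W.#Up (i ∷ w) (+ 0) a ≡ W.#Up w (+ 0) a
    same-Up = card-unique (W.Up-card (i ∷ w) (+ 0) a) (W.Up-card w (+ 0) a)
      (λ x (x<0 , a≤sv) → x<0 , ℤP.≮⇒≥ λ v<a → ℤP.<⇒≱ (s-below i _ v<a) a≤sv)
      (λ x (x<0 , a≤v) → x<0 , ℤP.≮⇒≥ λ sv<a → ℤP.<⇒≱ (s-below⁻ i _ sv<a) a≤v)

module Presented (n : ℕ) .{{_ : NonZero n}} (2≤n : 2 ℕ.≤ n) (f g : ℤ → ℤ) (w : List (Fin n))
    (f≡w : ∀ x → f x ≡ word n w x) (g∘f : ∀ x → g (f x) ≡ x) (f∘g : ∀ x → f (g x) ≡ x) where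
  open Words n 2≤n
  open WordBalance n 2≤n
  open Counting

  f-periodic : ∀ x → f (x + + n) ≡ f x + + n
  f-periodic x = trans (f≡w _) (trans (word-periodic w x) (cong (_+ + n) (sym (f≡w x))))

  open AffinePermutation n f g f-periodic g∘f f∘g

  -- The flux only depends on the values of f, so f is balanced like w.
  balanced : flux (+ 0) (+ 0) ≡ + 0
  balanced = trans (cong₂ (λ p q → + p - + q) same-Down same-Up) (word-balanced w)
    where
    same-Down : #Down (+ 0) (+ 0) ≡ W.#Down w (+ 0) (+ 0)
    same-Down = card-unique (Down-card (+ 0) (+ 0)) (W.Down-card w (+ 0) (+ 0))
      (λ x (0≤x , fx<0) → 0≤x , subst (_< + 0) (f≡w x) fx<0)
      (λ x (0≤x , wx<0) → 0≤x , subst (_< + 0) (sym (f≡w x)) wx<0)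
    same-Up : #Up (+ 0) (+ 0) ≡ W.#Up w (+ 0) (+ 0)
    same-Up = card-unique (Up-card (+ 0) (+ 0)) (W.Up-card w (+ 0) (+ 0))
      (λ x (x<0 , 0≤fx) → x<0 , subst (+ 0 ≤_) (f≡w x) 0≤fx)
      (λ x (x<0 , 0≤wx) → x<0 , subst (+ 0 ≤_) (sym (f≡w x)) 0≤wx)

  max-δ≡max-c : (c : ℤ → ℕ) → (∀ i → IsC f i (c i)) → ∃ λ m → IsMax (δ f) m × IsMax (λ i → + c i) m
  max-δ≡max-c c c-spec = Balanced.max-δ≡max-c balanced c c-spec

-- δ g (f i) = − δ f i for inverse bijections, so min δ f = − max δ g.
min-δ-via-inverse : ∀ {f g M} → IsInverse f g → IsMax (δ g) M → IsMin (δ f) (- M)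
min-δ-via-inverse {f} {g} {M} (g∘f , f∘g) ((j , δg[j]≡M) , δg≤M) = (g j , δf[gj]≡-M) , -M≤δf
  where
  negate : ∀ x y → x - y ≡ - (y - x)
  negate = solve-∀
  δf[gj]≡-M : δ f (g j) ≡ - M
  δf[gj]≡-M = trans (cong (_- g j) (f∘g j)) (trans (negate j (g j)) (cong -_ δg[j]≡M))
  δg[fi]≡-δf : ∀ i → δ g (f i) ≡ - δ f i
  δg[fi]≡-δf i = trans (cong (_- f i) (g∘f i)) (negate i (f i))
  -M≤δf : ∀ i → - M ≤ δ f i
  -M≤δf i = subst (- M ≤_) (trans (cong -_ (δg[fi]≡-δf i)) (ℤP.neg-involutive (δ f i)))
    (ℤP.neg-mono-≤ (δg≤M (f i)))

lemma2p19 : (n : ℕ) .{{_ : NonZero n}} → 2 Data.Nat.≤ n →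
    (f g : ℤ → ℤ) → InS0 n f → IsInverse f g →
    (c c⁻ : ℤ → ℕ) → (∀ i → IsC f i (c i)) → (∀ i → IsC g i (c⁻ i)) →
    (∃ λ m → IsMax (δ f) m × IsMax (λ i → + c i) m)
    × (∃ λ m → IsMin (δ f) m × IsMax (λ i → + c⁻ i) (- m))
lemma2p19 n 2≤n f g (w , f≡w) (g∘f , f∘g) c c⁻ c-spec c⁻-spec =
  Presented.max-δ≡max-c n 2≤n f g w f≡w g∘f f∘g c c-spec ,
  min-part (Presented.max-δ≡max-c n 2≤n g f (reverse w) g≡w⁻¹ f∘g g∘f c⁻ c⁻-spec)
  where
  open Words n 2≤n
  g≡w⁻¹ : ∀ x → g x ≡ word n (reverse w) x
  g≡w⁻¹ x = trans (cong g (sym (trans (f≡w _) (word-reverse-inverseʳ w x)))) (g∘f _)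
  min-part : (∃ λ m → IsMax (δ g) m × IsMax (λ i → + c⁻ i) m) →
    ∃ λ m → IsMin (δ f) m × IsMax (λ i → + c⁻ i) (- m)
  min-part (M , max-δg , max-c⁻) =
    - M , min-δ-via-inverse {f} {g} (g∘f , f∘g) max-δg ,
    subst (IsMax (λ i → + c⁻ i)) (sym (ℤP.neg-involutive M)) max-c⁻
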